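{- Let $\ell\ge4$ be an integer, $f$ a slow function and $G$ the $(f,\ell)$-layered wheel with layers $L_1,L_2,\dots$. For every integer $i\ge 2$, $\omega(G[L_1\cup\dots\cup L_i])=f(i)$.
   Context: $\omega$ denotes the clique number. A function $f:\mathbb N\setminus\{0\}\to\mathbb N\setminus\{0\}$ is slow if $f(1)=1,f(2)=2,f(3)=3$ and $f(i)\le f(i+1)\le f(i)+1$ for all $i$. The $(f,\ell)$-layered wheel $G$ is the infinite graph (considered as an undirected simple graph; orientations only descriptive) whose vertex set is partitioned into finite layers $L_1,L_2,\dots$, built inductively. For $v\in L_i$ let $N^\uparrow(v)$ be the set of neighbours of $v$ in $L_1\cup\dots\cup L_{i-1}$ and $N^\uparrow[v]=N^\uparrow(v)\cup\{v\}$. $L_1$ induces a directed cycle of length $\ell$. Given $L_1,\dots,L_i$, for each $v\in L_i$ create a directed path $L(v)=v_1\dots v_{n_v}$ of new vertices: (a) if $|N^\uparrow(v)|<f(i+1)-1$, then $n_v=\ell-2$, $N^\uparrow(v_1)=N^\uparrow[v]$ and $N^\uparrow(v_j)=\emptyset$ for $j\ge2$; (b) if $|N^\uparrow(v)|=f(i+1)-1=:m$, write $N^\uparrow(v)=\{w_1,\dots,w_m\}$; then $n_v=m(\ell-2)$, $N^\uparrow(v_{(j-1)(\ell-2)+1})=N^\uparrow[v]\setminus\{w_j\}$ for $j=1,\dots,m$, and all other vertices of $L(v)$ have $N^\uparrow=\emptyset$ (the construction guarantees $|N^\uparrow(v)|\le f(i+1)-1$ always). Specifying $N^\uparrow(u)$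 for a new vertex $u$ means $u$ is adjacent exactly to those vertices of earlier layers. $L_{i+1}=\bigcup_{v\in L_i}V(L(v))$ induces the directed cycle obtained from the paths $L(v)$ by adding, for every arc $vv'$ of the cycle $L_i$, the arc $v_{n_v}v'_1$. -}

module Defs where

open import Data.Nat using (ℕ; zero; suc; _∸_; _≤_; _<_; _<?_)
open import Data.Product using (_×_; _,_)
open import Data.Sum using (_⊎_)
open import Data.List using (List; []; _∷_; _++_; replicate; length; map; concatMap)
open import Data.List.Membership.Propositional using (_∈_)
open import Data.List.Relation.Unary.AllPairs using (AllPairs)
open import Relation.Binary.PropositionalEquality using (_≡_; _≢_)
open import Relation.Nullary using (yes; no)

-- A slow function f : ℕ∖{0} → ℕ∖{0}; the value f 0 is irrelevant.
record Slow (f : ℕ → ℕ) : Set where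
  field
    f1 : f 1 ≡ 1
    f2 : f 2 ≡ 2
    f3 : f 3 ≡ 3
    mono : ∀ i → 1 ≤ i → f i ≤ f (suc i)
    step : ∀ i → 1 ≤ i → f (suc i) ≤ suc (f i)

-- A vertex is named (layer number i ≥ 1, position k ≥ 0 in the cyclic order of L_i).
Vtx : Set
Vtx = ℕ × ℕ

deletions : {A : Set} → List A → List (List A)
deletions []       = []
deletions (x ∷ xs) = xs ∷ map (x ∷_) (deletions xs)

-- A layer is the list (in cyclic order) of the up-neighbourhoods N↑ of its vertices.
module Construction (f : ℕ → ℕ) (ℓ : ℕ) where

  -- a path of ℓ-2 vertices whose first vertex has up-neighbourhood U
  block : List Vtx → List (List Vtx)
  block U = U ∷ replicate (ℓ ∸ 3) []

  -- the path L(v) for v = (i , k) with N↑(v) = U, new layer i+1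
  expand : ℕ → ℕ → List Vtx → List (List Vtx)
  expand i k U with length U <? f (suc i) ∸ 1
  ... | yes _ = block ((i , k) ∷ U)
  ... | no  _ = concatMap (λ U' → block ((i , k) ∷ U')) (deletions U)

  go : ℕ → ℕ → List (List Vtx) → List (List Vtx)
  go i k []       = []
  go i k (U ∷ Us) = expand i k U ++ go i (suc k) Us

  -- layer i (for i ≥ 1; layer 0 is a dummy empty layer)
  layer : ℕ → List (List Vtx)
  layer zero = []
  layer (suc zero) = replicate ℓ []
  layer (suc (suc i)) = go (suc i) 0 (layer (suc i))

  size : ℕ → ℕ
  size i = length (layer i)

  at : List (List Vtx) → ℕ → List Vtx
  at []       _       = []
  at (U ∷ Us) zero    = U
  at (U ∷ Us) (suc k) = at Us k

  up : Vtx → List Vtx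
  up (i , k) = at (layer i) k

  InLayers : ℕ → Vtx → Set
  InLayers i (j , k) = 1 ≤ j × j ≤ i × k < size j

  Arc : Vtx → Vtx → Set
  Arc (i , k) (j , k') =
    (i ≡ j × ((k' ≡ suc k) ⊎ (suc k ≡ size i × k' ≡ 0))) ⊎ ((j , k') ∈ up (i , k))

  Adj : Vtx → Vtx → Set
  Adj u v = Arc u v ⊎ Arc v u

  IsClique : ℕ → List Vtx → Set
  IsClique i C = (∀ {v} → v ∈ C → InLayers i v) × AllPairs (λ u v → u ≢ v × Adj u v) C

  CliqueNumber≡ : ℕ → ℕ → Set
  CliqueNumber≡ i n =
    (Data.Product.∃ λ C → IsClique i C × length C ≡ n) ×
    (∀ C → IsClique i C → length C ≤ n)

-- Lower bound: by induction every layer L_i has a vertex v whose up-neighbourhood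
-- is a clique of size f i - 1, so {v} ∪ N↑(v) is a clique of size f i; slowness of f
-- lets the first vertex of the path L(v) inherit this.
-- Upper bound: let u be a vertex of a clique C in the highest layer that C meets. If
-- no other vertex of C lies in that layer, C ⊆ {u} ∪ N↑(u), and |N↑(u)| ≤ f i - 1 is
-- an invariant of the construction. Otherwise two adjacent vertices of C share that
-- layer; as one of any two consecutive vertices of a layer has no up-neighbours, all
-- of C lies in that layer, which induces a cycle of length at least 4, so |C| ≤ 2 ≤ f i.
module Submission where

open import Defs
open import Data.Nat using (ℕ; zero; suc; _+_; _∸_; _≤_; _<_; z≤n; s≤s)
open import Data.Nat.Properties
open import Data.Product using (_×_; _,_; proj₁; proj₂; ∃)
open import Data.Product.Properties using (≡-dec)
open import Data.Sum using (_⊎_; inj₁; inj₂; swap; map₂)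
open import Data.Empty using (⊥; ⊥-elim)
open import Data.Unit using (⊤; tt)
open import Data.List using (List; []; _∷_; _++_; replicate; length; concatMap)
open import Data.List.Properties using (length-++; length-replicate)
open import Data.List.Membership.Propositional using (_∈_; lose; find)
open import Data.List.Membership.Propositional.Properties
  using (∈-++⁻; ∈-++⁺ˡ; ∈-++⁺ʳ; ∈-map⁻; ∈-concatMap⁻; ∉[])
open import Data.List.Relation.Binary.Subset.Propositional using (_⊆_)
open import Data.List.Relation.Unary.Any using (here; there; any?)
open import Data.List.Relation.Unary.All as All using (_∷_)
open import Data.List.Relation.Unary.All.Properties using (anti-mono; replicate⁺)
open import Data.List.Relation.Unary.AllPairs as AllPairs using (AllPairs; []; _∷_)
open import Data.List.Relation.Unary.Unique.Propositional using (Unique)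
open import Data.List.Extrema ≤-totalOrder using (argmax; argmax-sel; f[⊥]≤f[argmax]; f[xs]≤f[argmax])
open import Function using (id; _∘_)
open import Relation.Binary.Definitions using (Symmetric)
open import Relation.Binary.PropositionalEquality
open import Relation.Nullary using (yes; no; Dec)
open import Relation.Nullary.Decidable using (¬?; _×-dec_)

private
  variable
    A : Set

∈-remove : {x : A} {ys : List A} → x ∈ ys →
  ∃ λ zs → suc (length zs) ≡ length ys × (∀ {y} → y ∈ ys → y ≢ x → y ∈ zs)
∈-remove {ys = y ∷ ys} (here refl) = ys , refl , λ { (here refl) y≢y → ⊥-elim (y≢y refl) ; (there q) _ → q }
∈-remove {ys = y ∷ ys} (there x∈ys) with ∈-remove x∈ys
... | zs , |zs|≡ , keep =
  y ∷ zs , cong suc |zs|≡ , λ { (here refl) _ → here refl ; (there q) ≢x → there (keep q ≢x) }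

Unique-⊆⇒length≤ : {xs ys : List A} → Unique xs → xs ⊆ ys → length xs ≤ length ys
Unique-⊆⇒length≤ {xs = []} _ _ = z≤n
Unique-⊆⇒length≤ {xs = x ∷ xs} (x∉xs ∷ uxs) xs⊆ys with ∈-remove (xs⊆ys (here refl))
... | zs , |zs|≡ , keep = subst (suc (length xs) ≤_) |zs|≡ (s≤s (Unique-⊆⇒length≤ uxs xs⊆zs))
  where
    xs⊆zs : xs ⊆ zs
    xs⊆zs y∈xs = keep (xs⊆ys (there y∈xs)) (λ y≡x → All.lookup x∉xs y∈xs (sym y≡x))

AllPairs-lookup : {R : A → A → Set} → Symmetric R → {xs : List A} → AllPairs R xs →
  ∀ {x y} → x ∈ xs → y ∈ xs → x ≢ y → R x y
AllPairs-lookup sym (_ ∷ _) (here refl) (here refl) x≢x = ⊥-elim (x≢x refl)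
AllPairs-lookup sym (rx ∷ _) (here refl) (there y∈xs) _ = All.lookup rx y∈xs
AllPairs-lookup sym (rx ∷ _) (there x∈xs) (here refl) _ = sym (All.lookup rx x∈xs)
AllPairs-lookup sym (_ ∷ rxs) (there x∈xs) (there y∈xs) x≢y = AllPairs-lookup sym rxs x∈xs y∈xs x≢y

∈-replicate⁻ : {x y : A} (n : ℕ) → y ∈ replicate n x → y ≡ x
∈-replicate⁻ {x = x} n = All.lookup (replicate⁺ {P = _≡ x} n refl)

argmax-∈-∀≤ : (key : A → ℕ) (c : A) (cs : List A) →
  ∃ λ u → u ∈ c ∷ cs × (∀ {v} → v ∈ c ∷ cs → key v ≤ key u)
argmax-∈-∀≤ key c cs = argmax key c cs , u∈ (argmax-sel key c cs) , ≤key
  where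
    u∈ : argmax key c cs ≡ c ⊎ argmax key c cs ∈ cs → argmax key c cs ∈ c ∷ cs
    u∈ (inj₁ u≡c) = here u≡c
    u∈ (inj₂ u∈cs) = there u∈cs
    ≤key : ∀ {v} → v ∈ c ∷ cs → key v ≤ key (argmax key c cs)
    ≤key (here refl) = f[⊥]≤f[argmax] {f = key} c cs
    ≤key (there v∈cs) = All.lookup (f[xs]≤f[argmax] {f = key} c cs) v∈cs

deletion-⊆ : {U U' : List A} → U' ∈ deletions U → U' ⊆ U
deletion-⊆ {U = x ∷ xs} (here refl) = there
deletion-⊆ {U = x ∷ xs} (there m) with ∈-map⁻ (x ∷_) m
... | _ , m' , refl = λ { (here refl) → here refl ; (there q) → there (deletion-⊆ m' q) }

deletion-AllPairs : {R : A → A → Set} {U U' : List A} → AllPairs R U → U' ∈ deletions U → AllPairs R U'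
deletion-AllPairs (_ ∷ rxs) (here refl) = rxs
deletion-AllPairs {U = x ∷ xs} (rx ∷ rxs) (there m) with ∈-map⁻ (x ∷_) m
... | _ , m' , refl = anti-mono (deletion-⊆ m') rx ∷ deletion-AllPairs rxs m'

deletion-length : {U U' : List A} → U' ∈ deletions U → suc (length U') ≡ length U
deletion-length {U = x ∷ xs} (here refl) = refl
deletion-length {U = x ∷ xs} (there m) with ∈-map⁻ (x ∷_) m
... | _ , m' , refl = cong suc (deletion-length m')

-- Of any two consecutive entries one is empty, and so is the last one: read
-- cyclically, every arc of a layer then has an endpoint without up-neighbours.
Sparse : List (List A) → Set
Sparse [] = ⊤
Sparse (U ∷ []) = U ≡ []
Sparse (U ∷ V ∷ Us) = (U ≡ [] ⊎ V ≡ []) × Sparse (V ∷ Us)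

Sparse-++ : (Us Vs : List (List A)) → Sparse Us → Sparse Vs → Sparse (Us ++ Vs)
Sparse-++ [] Vs _ sVs = sVs
Sparse-++ (U ∷ []) [] sUs _ = sUs
Sparse-++ (U ∷ []) (V ∷ Vs) U≡[] sVs = inj₁ U≡[] , sVs
Sparse-++ (U ∷ U' ∷ Us) Vs (e , sUs) sVs = e , Sparse-++ (U' ∷ Us) Vs sUs sVs

Sparse-replicate : ∀ n → Sparse {A} (replicate n [])
Sparse-replicate zero = tt
Sparse-replicate (suc zero) = refl
Sparse-replicate (suc (suc n)) = inj₁ refl , Sparse-replicate (suc n)

Sparse-∷-replicate : (U : List A) (n : ℕ) → 1 ≤ n → Sparse (U ∷ replicate n [])
Sparse-∷-replicate U (suc n) _ = inj₂ refl , Sparse-replicate (suc n)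

Sparse-concatMap : {B : Set} (g : B → List (List A)) (xs : List B) → (∀ x → Sparse (g x)) →
  Sparse (concatMap g xs)
Sparse-concatMap g [] _ = tt
Sparse-concatMap g (x ∷ xs) sg = Sparse-++ (g x) _ (sg x) (Sparse-concatMap g xs sg)

-- Adjacency on the cycle 0, 1, …, n-1; the bounds a, b < n are kept separately.
data CycleAdj (n : ℕ) : ℕ → ℕ → Set where
  fwd : ∀ {a} → CycleAdj n a (suc a)
  bwd : ∀ {a} → CycleAdj n (suc a) a
  wrap-fwd : ∀ {a} → suc a ≡ n → CycleAdj n a 0
  wrap-bwd : ∀ {b} → suc b ≡ n → CycleAdj n 0 b

-- Apart from the triangles of a 3-cycle, every case forces two of the positions to coincide.
CycleAdj-triangle-free : ∀ {n a b c} → 4 ≤ n → a ≢ b → a ≢ c → b ≢ c →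
  CycleAdj n a b → CycleAdj n a c → CycleAdj n b c → ⊥
CycleAdj-triangle-free _ _ _ b≢c fwd fwd _ = b≢c refl
CycleAdj-triangle-free (s≤s (s≤s (s≤s ()))) _ _ _ fwd bwd (wrap-fwd refl)
CycleAdj-triangle-free _ _ a≢c _ fwd (wrap-fwd refl) bwd = a≢c refl
CycleAdj-triangle-free (s≤s (s≤s (s≤s ()))) _ _ _ fwd (wrap-bwd refl) fwd
CycleAdj-triangle-free (s≤s (s≤s (s≤s ()))) _ _ _ bwd fwd (wrap-bwd refl)
CycleAdj-triangle-free _ _ _ b≢c bwd bwd _ = b≢c refl
CycleAdj-triangle-free (s≤s (s≤s (s≤s ()))) _ _ _ bwd (wrap-fwd refl) bwd
CycleAdj-triangle-free _ a≢b _ _ (wrap-fwd refl) fwd fwd = a≢b refl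
CycleAdj-triangle-free (s≤s (s≤s (s≤s ()))) _ _ _ (wrap-fwd refl) bwd fwd
CycleAdj-triangle-free _ _ _ b≢c (wrap-fwd refl) (wrap-fwd refl) _ = b≢c refl
CycleAdj-triangle-free _ _ a≢c _ (wrap-fwd refl) (wrap-bwd refl) _ = a≢c refl
CycleAdj-triangle-free _ a≢b _ _ (wrap-bwd refl) fwd fwd = a≢b refl
CycleAdj-triangle-free (s≤s (s≤s (s≤s ()))) _ _ _ (wrap-bwd refl) fwd bwd
CycleAdj-triangle-free _ _ a≢c _ (wrap-bwd refl) (wrap-fwd refl) _ = a≢c refl
CycleAdj-triangle-free _ _ _ b≢c (wrap-bwd refl) (wrap-bwd refl) _ = b≢c refl

suc[n∸1]≡n : ∀ {n} → 1 ≤ n → suc (n ∸ 1) ≡ n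
suc[n∸1]≡n {suc n} _ = refl

module _ {f : ℕ → ℕ} (sf : Slow f) where
  open Slow sf

  slow-mono : ∀ {a b} → 1 ≤ a → a ≤ b → f a ≤ f b
  slow-mono {a} {zero} 1≤a a≤0 = ⊥-elim (<⇒≱ 1≤a a≤0)
  slow-mono {a} {suc b} 1≤a a≤1+b with m≤n⇒m<n∨m≡n a≤1+b
  ... | inj₁ (s≤s a≤b) = ≤-trans (slow-mono 1≤a a≤b) (mono b (≤-trans 1≤a a≤b))
  ... | inj₂ refl = ≤-refl

  1≤slow : ∀ m → 1 ≤ f (suc m)
  1≤slow m = subst (_≤ f (suc m)) f1 (slow-mono ≤-refl (s≤s z≤n))

  2≤slow : ∀ i → 2 ≤ i → 2 ≤ f i
  2≤slow i 2≤i = subst (_≤ f i) f2 (slow-mono (s≤s z≤n) 2≤i)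

module LayeredWheel (ℓ : ℕ) (4≤ℓ : 4 ≤ ℓ) (f : ℕ → ℕ) (sf : Slow f) where
  open Construction f ℓ
  open Slow sf

  _~_ : Vtx → Vtx → Set
  u ~ v = u ≢ v × Adj u v

  ~-sym : Symmetric _~_
  ~-sym (u≢v , uv) = (λ v≡u → u≢v (sym v≡u)) , swap uv

  _≟ᵥ_ : (u v : Vtx) → Dec (u ≡ v)
  _≟ᵥ_ = ≡-dec _≟_ _≟_

  InLayers-suc : ∀ {m v} → InLayers m v → InLayers (suc m) v
  InLayers-suc (1≤j , j≤m , k<) = 1≤j , m≤n⇒m≤1+n j≤m , k<

  at-∈ : ∀ Us k → at Us k ≡ [] ⊎ at Us k ∈ Us
  at-∈ [] k = inj₁ refl
  at-∈ (U ∷ Us) zero = inj₂ (here refl)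
  at-∈ (U ∷ Us) (suc k) = map₂ there (at-∈ Us k)

  ∈⇒at : ∀ {Us U} → U ∈ Us → ∃ λ k → k < length Us × at Us k ≡ U
  ∈⇒at (here refl) = 0 , s≤s z≤n , refl
  ∈⇒at (there U∈Us) with ∈⇒at U∈Us
  ... | k , k< , atk = suc k , s≤s k< , atk

  Sparse-adjacent : ∀ Us k → Sparse Us → suc k < length Us → at Us k ≡ [] ⊎ at Us (suc k) ≡ []
  Sparse-adjacent (U ∷ []) zero _ (s≤s ())
  Sparse-adjacent (U ∷ V ∷ Us) zero (e , _) _ = e
  Sparse-adjacent (U ∷ V ∷ Us) (suc k) (_ , sUs) (s≤s k<) = Sparse-adjacent (V ∷ Us) k sUs k<

  Sparse-last : ∀ Us k → Sparse Us → suc k ≡ length Us → at Us k ≡ []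
  Sparse-last (U ∷ []) zero U≡[] refl = U≡[]
  Sparse-last (U ∷ V ∷ Us) (suc k) (_ , sUs) |Us|≡ = Sparse-last (V ∷ Us) k sUs (suc-injective |Us|≡)

  Sparse-CycleAdj : ∀ {Us a b} → Sparse Us → CycleAdj (length Us) a b →
    a < length Us → b < length Us → at Us a ≡ [] ⊎ at Us b ≡ []
  Sparse-CycleAdj {Us} {a} sUs fwd _ b< = Sparse-adjacent Us a sUs b<
  Sparse-CycleAdj {Us} {b = b} sUs bwd a< _ = swap (Sparse-adjacent Us b sUs a<)
  Sparse-CycleAdj {Us} {a} sUs (wrap-fwd |Us|≡) _ _ = inj₁ (Sparse-last Us a sUs |Us|≡)
  Sparse-CycleAdj {Us} {b = b} sUs (wrap-bwd |Us|≡) _ _ = inj₂ (Sparse-last Us b sUs |Us|≡)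

  ∈-block : ∀ {U W} → W ∈ block U → W ≡ U ⊎ W ≡ []
  ∈-block (here refl) = inj₁ refl
  ∈-block (there W∈) = inj₂ (∈-replicate⁻ (ℓ ∸ 3) W∈)

  Sparse-block : ∀ U → Sparse (block U)
  Sparse-block U = Sparse-∷-replicate U (ℓ ∸ 3) (∸-monoˡ-≤ 3 4≤ℓ)

  -- The up-neighbourhoods of the vertices of L((i , k)) when N↑((i , k)) = U;
  -- the two length alternatives are cases (a) and (b) of the construction.
  data ExpandedUp (i k : ℕ) (U : List Vtx) : List Vtx → Set where
    bare : ExpandedUp i k U []
    cone : ∀ {U'} → U' ⊆ U → (AllPairs _~_ U → AllPairs _~_ U') →
      suc (length U') ≤ f (suc i) ∸ 1 ⊎ suc (length U') ≡ length U →
      ExpandedUp i k U ((i , k) ∷ U')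

  ∈-expand : ∀ {i k U W} → W ∈ expand i k U → ExpandedUp i k U W
  ∈-expand {i} {k} {U} W∈ with length U <? f (suc i) ∸ 1
  ... | yes |U|< with ∈-block W∈
  ...   | inj₁ refl = cone id id (inj₁ |U|<)
  ...   | inj₂ refl = bare
  ∈-expand {i} {k} {U} W∈ | no _ with find (∈-concatMap⁻ (λ U' → block ((i , k) ∷ U')) {xs = deletions U} W∈)
  ... | U' , U'∈ , W∈block with ∈-block W∈block
  ...   | inj₁ refl = cone (deletion-⊆ U'∈) (λ cl → deletion-AllPairs cl U'∈) (inj₂ (deletion-length U'∈))
  ...   | inj₂ refl = bare

  -- As f (suc i) is f i or f i + 1, the first vertex of L(v) is again saturated:
  -- in case (a) it adds v to N↑(v), in case (b) it trades w₁ for v.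
  expand-saturated : ∀ m k U → length U ≡ f (suc m) ∸ 1 →
    ∃ λ W → W ∈ expand (suc m) k U × length W ≡ f (suc (suc m)) ∸ 1
  expand-saturated m k U |U|≡ with length U <? f (suc (suc m)) ∸ 1
  ... | yes |U|< = _ , here refl , ≤-antisym |U|< (begin
    f (suc (suc m)) ∸ 1     ≤⟨ ∸-monoˡ-≤ 1 (step (suc m) (s≤s z≤n)) ⟩
    f (suc m)               ≡⟨ suc[n∸1]≡n (1≤slow sf m) ⟨
    suc (f (suc m) ∸ 1)     ≡⟨ cong suc |U|≡ ⟨
    suc (length U)          ∎)
    where open ≤-Reasoning
  expand-saturated m k [] |U|≡ | no |U|≮ = ⊥-elim (|U|≮ (∸-monoˡ-≤ 1 (2≤slow sf (suc (suc m)) (s≤s (s≤s z≤n)))))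
  expand-saturated m k (x ∷ xs) |U|≡ | no |U|≮ =
    _ , here refl , ≤-antisym (subst (_≤ f (suc (suc m)) ∸ 1) (sym |U|≡) (∸-monoˡ-≤ 1 (mono (suc m) (s≤s z≤n)))) (≮⇒≥ |U|≮)

  expand-nonempty : ∀ i k U → 2 ≤ f (suc i) → 1 ≤ length (expand i k U)
  expand-nonempty i k U 2≤f with length U <? f (suc i) ∸ 1
  ... | yes _ = s≤s z≤n
  expand-nonempty i k [] 2≤f | no |U|≮ = ⊥-elim (|U|≮ (∸-monoˡ-≤ 1 2≤f))
  expand-nonempty i k (_ ∷ _) 2≤f | no _ = s≤s z≤n

  Sparse-expand : ∀ i k U → Sparse (expand i k U)
  Sparse-expand i k U with length U <? f (suc i) ∸ 1
  ... | yes _ = Sparse-block _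
  ... | no _ = Sparse-concatMap _ (deletions U) (λ _ → Sparse-block _)

  Sparse-go : ∀ i k Us → Sparse (go i k Us)
  Sparse-go i k [] = tt
  Sparse-go i k (U ∷ Us) = Sparse-++ (expand i k U) _ (Sparse-expand i k U) (Sparse-go i (suc k) Us)

  length-go : ∀ i k Us → 2 ≤ f (suc i) → length Us ≤ length (go i k Us)
  length-go i k [] _ = z≤n
  length-go i k (U ∷ Us) 2≤f rewrite length-++ (expand i k U) {go i (suc k) Us} =
    +-mono-≤ (expand-nonempty i k U 2≤f) (length-go i (suc k) Us 2≤f)

  ∈-go⁻ : ∀ i k Us {W} → W ∈ go i k Us → ∃ λ p → p < length Us × W ∈ expand i (k + p) (at Us p)
  ∈-go⁻ i k (U ∷ Us) {W} W∈ with ∈-++⁻ (expand i k U) W∈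
  ... | inj₁ W∈e = 0 , s≤s z≤n , subst (λ k' → W ∈ expand i k' U) (sym (+-identityʳ k)) W∈e
  ... | inj₂ W∈g with ∈-go⁻ i (suc k) Us W∈g
  ...   | p , p< , W∈e = suc p , s≤s p< , subst (λ k' → W ∈ expand i k' (at Us p)) (sym (+-suc k p)) W∈e

  ∈-go⁺ : ∀ i k Us p {W} → p < length Us → W ∈ expand i (k + p) (at Us p) → W ∈ go i k Us
  ∈-go⁺ i k (U ∷ Us) zero {W} _ W∈e = ∈-++⁺ˡ (subst (λ k' → W ∈ expand i k' U) (+-identityʳ k) W∈e)
  ∈-go⁺ i k (U ∷ Us) (suc p) {W} (s≤s p<) W∈e =
    ∈-++⁺ʳ (expand i k U) (∈-go⁺ i (suc k) Us p p< (subst (λ k' → W ∈ expand i k' (at Us p)) (+-suc k p) W∈e))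

  record Admissible (m : ℕ) (U : List Vtx) : Set where
    field
      isClique : IsClique m U
      bounded : length U ≤ f (suc m) ∸ 1

  admissible-[] : ∀ m → Admissible m []
  admissible-[] m = record { isClique = (λ ()) , [] ; bounded = z≤n }

  -- LayerInvariant m describes layer suc m, whose up-neighbourhoods lie in layers 1, …, m.
  record LayerInvariant (m : ℕ) : Set where
    field
      admissible : ∀ {U} → U ∈ layer (suc m) → Admissible m U
      sparse : Sparse (layer (suc m))
      4≤size : 4 ≤ size (suc m)
      saturated : ∃ λ U → U ∈ layer (suc m) × length U ≡ f (suc m) ∸ 1

  module _ {m} (inv : LayerInvariant m) where
    open LayerInvariant inv

    admissible-up : ∀ k → Admissible m (up (suc m , k))
    admissible-up k with at-∈ (layer (suc m)) k
    ... | inj₁ up≡[] rewrite up≡[] = admissible-[] m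
    ... | inj₂ up∈ = admissible up∈

    cone-IsClique : ∀ {p U} → p < size (suc m) → U ⊆ up (suc m , p) → AllPairs _~_ U →
      IsClique (suc m) ((suc m , p) ∷ U)
    cone-IsClique {p} {U} p< U⊆ cl = inLayers , All.tabulate joined ∷ cl
      where
        below : ∀ {w} → w ∈ U → InLayers m w
        below w∈ = proj₁ (Admissible.isClique (admissible-up p)) (U⊆ w∈)
        inLayers : ∀ {w} → w ∈ (suc m , p) ∷ U → InLayers (suc m) w
        inLayers (here refl) = s≤s z≤n , ≤-refl , p<
        inLayers (there w∈) = InLayers-suc (below w∈)
        joined : ∀ {w} → w ∈ U → (suc m , p) ~ w
        joined w∈ = (λ v≡w → <⇒≱ (s≤s (proj₁ (proj₂ (below w∈)))) (≤-reflexive (cong proj₁ v≡w))) ,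
                    inj₁ (inj₂ (U⊆ w∈))

    expand-admissible : ∀ {p W} → p < size (suc m) → W ∈ expand (suc m) p (up (suc m , p)) →
      Admissible (suc m) W
    expand-admissible {p} p< W∈ with ∈-expand W∈
    ... | bare = admissible-[] (suc m)
    ... | cone {U'} U'⊆ clique⇒ |U'|≤ = record
      { isClique = cone-IsClique p< U'⊆ (clique⇒ (proj₂ isClique))
      ; bounded = bounded′ |U'|≤
      }
      where
        open Admissible (admissible-up p)
        bounded′ : suc (length U') ≤ f (suc (suc m)) ∸ 1 ⊎ suc (length U') ≡ length (up (suc m , p)) →
          suc (length U') ≤ f (suc (suc m)) ∸ 1
        bounded′ (inj₁ |U'|<) = |U'|<
        bounded′ (inj₂ |U'|≡) rewrite |U'|≡ = ≤-trans bounded (∸-monoˡ-≤ 1 (mono (suc m) (s≤s z≤n)))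

    saturated-next : ∃ λ W → W ∈ layer (suc (suc m)) × length W ≡ f (suc (suc m)) ∸ 1
    saturated-next with saturated
    ... | U , U∈ , |U|≡ with ∈⇒at U∈
    ...   | p , p< , up≡U with expand-saturated m p U |U|≡
    ...     | W , W∈ , |W|≡ =
      W , ∈-go⁺ (suc m) 0 (layer (suc m)) p p< (subst (λ U' → W ∈ expand (suc m) p U') (sym up≡U) W∈) , |W|≡

    invariant-next : LayerInvariant (suc m)
    invariant-next = record
      { admissible = λ W∈ → let p , p< , W∈e = ∈-go⁻ (suc m) 0 (layer (suc m)) W∈ in expand-admissible p< W∈e
      ; sparse = Sparse-go (suc m) 0 (layer (suc m))
      ; 4≤size = ≤-trans 4≤size (length-go (suc m) 0 (layer (suc m)) (2≤slow sf (suc (suc m)) (s≤s (s≤s z≤n))))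
      ; saturated = saturated-next
      }

  invariant-first : LayerInvariant 0
  invariant-first = record
    { admissible = λ U∈ → subst (Admissible 0) (sym (∈-replicate⁻ ℓ U∈)) (admissible-[] 0)
    ; sparse = Sparse-replicate ℓ
    ; 4≤size = subst (4 ≤_) (sym (length-replicate ℓ)) 4≤ℓ
    ; saturated = [] , []∈layer₁ , cong (_∸ 1) (sym f1)
    }

    where
      []∈layer₁ : [] ∈ replicate ℓ []
      []∈layer₁ = subst (λ n → [] ∈ replicate n []) (suc[n∸1]≡n (≤-trans (s≤s z≤n) 4≤ℓ)) (here refl)

  invariant : ∀ m → LayerInvariant m
  invariant zero = invariant-first
  invariant (suc m) = invariant-next (invariant m)

  up-below : ∀ {j k w} → w ∈ up (j , k) → proj₁ w < j
  up-below {zero} ()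
  up-below {suc m} {k} w∈ =
    s≤s (proj₁ (proj₂ (proj₁ (Admissible.isClique (admissible-up (invariant m) k)) w∈)))

  Adj-downward : ∀ {x w} → Adj x w → proj₁ w ≤ proj₁ x → proj₁ w ≡ proj₁ x ⊎ w ∈ up x
  Adj-downward (inj₁ (inj₁ (j≡ , _))) _ = inj₁ (sym j≡)
  Adj-downward (inj₁ (inj₂ w∈)) _ = inj₂ w∈
  Adj-downward (inj₂ (inj₁ (j≡ , _))) _ = inj₁ j≡
  Adj-downward (inj₂ (inj₂ x∈)) w≤x = ⊥-elim (<⇒≱ (up-below x∈) w≤x)

  Adj⇒CycleAdj : ∀ {j a b} → Adj (j , a) (j , b) → CycleAdj (size j) a b
  Adj⇒CycleAdj (inj₁ (inj₁ (_ , inj₁ refl))) = fwd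
  Adj⇒CycleAdj (inj₁ (inj₁ (_ , inj₂ (last , refl)))) = wrap-fwd last
  Adj⇒CycleAdj (inj₁ (inj₂ w∈)) = ⊥-elim (<-irrefl refl (up-below w∈))
  Adj⇒CycleAdj (inj₂ (inj₁ (_ , inj₁ refl))) = bwd
  Adj⇒CycleAdj (inj₂ (inj₁ (_ , inj₂ (last , refl)))) = wrap-bwd last
  Adj⇒CycleAdj (inj₂ (inj₂ w∈)) = ⊥-elim (<-irrefl refl (up-below w∈))

  clique-in-layer≤2 : ∀ {j} C → 4 ≤ size j → AllPairs _~_ C → (∀ {w} → w ∈ C → proj₁ w ≡ j) → length C ≤ 2
  clique-in-layer≤2 [] _ _ _ = z≤n
  clique-in-layer≤2 (_ ∷ []) _ _ _ = s≤s z≤n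
  clique-in-layer≤2 (_ ∷ _ ∷ []) _ _ _ = s≤s (s≤s z≤n)
  clique-in-layer≤2 ((_ , a) ∷ (_ , b) ∷ (_ , c) ∷ _) 4≤ ((ab ∷ ac ∷ _) ∷ (bc ∷ _) ∷ _) inLayer
    with inLayer (here refl) | inLayer (there (here refl)) | inLayer (there (there (here refl)))
  ... | refl | refl | refl = ⊥-elim (CycleAdj-triangle-free 4≤ (≢ ab) (≢ ac) (≢ bc) (cyc ab) (cyc ac) (cyc bc))
    where
      ≢ : ∀ {j x y} → (j , x) ~ (j , y) → x ≢ y
      ≢ (ne , _) x≡y = ne (cong (_ ,_) x≡y)
      cyc : ∀ {j x y} → (j , x) ~ (j , y) → CycleAdj (size j) x y
      cyc (_ , adj) = Adj⇒CycleAdj adj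

  top-neighbour : ∀ {C x w} → AllPairs _~_ C → x ∈ C → (∀ {v} → v ∈ C → proj₁ v ≤ proj₁ x) →
    w ∈ C → w ≢ x → proj₁ w ≡ proj₁ x ⊎ w ∈ up x
  top-neighbour cl x∈ top w∈ w≢x = Adj-downward (proj₂ (AllPairs-lookup ~-sym cl x∈ w∈ (w≢x ∘ sym))) (top w∈)

  lonely-top⇒⊆cone : ∀ {C u} → AllPairs _~_ C → u ∈ C → (∀ {w} → w ∈ C → proj₁ w ≤ proj₁ u) →
    (∀ {w} → w ∈ C → w ≢ u → proj₁ w ≢ proj₁ u) → C ⊆ u ∷ up u
  lonely-top⇒⊆cone {u = u} cl u∈ top lonely {w} w∈ with w ≟ᵥ u
  ... | yes refl = here refl
  ... | no w≢u with top-neighbour cl u∈ top w∈ w≢u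
  ...   | inj₁ same = ⊥-elim (lonely w∈ w≢u same)
  ...   | inj₂ w∈up = there w∈up

  bare-top⇒flat : ∀ {C x} → AllPairs _~_ C → x ∈ C → up x ≡ [] → (∀ {w} → w ∈ C → proj₁ w ≤ proj₁ x) →
    ∀ {w} → w ∈ C → proj₁ w ≡ proj₁ x
  bare-top⇒flat {x = x} cl x∈ up≡[] top {w} w∈ with w ≟ᵥ x
  ... | yes refl = refl
  ... | no w≢x with top-neighbour cl x∈ top w∈ w≢x
  ...   | inj₁ same = same
  ...   | inj₂ w∈up = ⊥-elim (∉[] (subst (w ∈_) up≡[] w∈up))

  lonely-top-bound : ∀ {C m k} → AllPairs _~_ C → (suc m , k) ∈ C → (∀ {w} → w ∈ C → proj₁ w ≤ suc m) →
    (∀ {w} → w ∈ C → w ≢ (suc m , k) → proj₁ w ≢ suc m) → length C ≤ f (suc m)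
  lonely-top-bound {C} {m} {k} cl u∈ top lonely = begin
    length C                         ≤⟨ Unique-⊆⇒length≤ (AllPairs.map proj₁ cl) (lonely-top⇒⊆cone cl u∈ top lonely) ⟩
    suc (length (up (suc m , k)))    ≤⟨ s≤s (Admissible.bounded (admissible-up (invariant m) k)) ⟩
    suc (f (suc m) ∸ 1)              ≡⟨ suc[n∸1]≡n (1≤slow sf m) ⟩
    f (suc m)                        ∎
    where open ≤-Reasoning

  shared-top-bound : ∀ {C m u v} → AllPairs _~_ C → u ∈ C → v ∈ C → u ≢ v →
    proj₁ u ≡ suc m → proj₁ v ≡ suc m → (∀ {w} → w ∈ C → InLayers (suc m) w) → length C ≤ 2
  shared-top-bound {C} {m} {u@(_ , _)} {v@(_ , _)} cl u∈ v∈ u≢v refl refl inC =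
    clique-in-layer≤2 C (LayerInvariant.4≤size (invariant m)) cl flat
    where
      one-bare : up u ≡ [] ⊎ up v ≡ []
      one-bare = Sparse-CycleAdj (LayerInvariant.sparse (invariant m))
        (Adj⇒CycleAdj (proj₂ (AllPairs-lookup ~-sym cl u∈ v∈ u≢v)))
        (proj₂ (proj₂ (inC u∈))) (proj₂ (proj₂ (inC v∈)))
      top : ∀ {w} → w ∈ C → proj₁ w ≤ suc m
      top w∈ = proj₁ (proj₂ (inC w∈))
      flat : ∀ {w} → w ∈ C → proj₁ w ≡ suc m
      flat with one-bare
      ... | inj₁ up≡[] = bare-top⇒flat cl u∈ up≡[] top
      ... | inj₂ up≡[] = bare-top⇒flat cl v∈ up≡[] top

  clique-bound : ∀ i → 2 ≤ i → ∀ C → IsClique i C → length C ≤ f i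
  clique-bound i 2≤i [] _ = z≤n
  clique-bound i 2≤i (c ∷ cs) (inC , cl) with argmax-∈-∀≤ proj₁ c cs
  ... | (zero , _) , u∈ , _ with () ← proj₁ (inC u∈)
  ... | (suc m , k) , u∈ , top with any? (λ v → ¬? (v ≟ᵥ (suc m , k)) ×-dec (proj₁ v ≟ suc m)) (c ∷ cs)
  ...   | no ∄mate = ≤-trans (lonely-top-bound cl u∈ top (λ w∈ w≢u same → ∄mate (lose w∈ (w≢u , same))))
                             (slow-mono sf (s≤s z≤n) (proj₁ (proj₂ (inC u∈))))
  ...   | yes ∃mate with find ∃mate
  ...     | v , v∈ , v≢u , same = ≤-trans (shared-top-bound cl u∈ v∈ (λ u≡v → v≢u (sym u≡v)) refl same inC′)
                                         (2≤slow sf i 2≤i)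
    where
      inC′ : ∀ {w} → w ∈ c ∷ cs → InLayers (suc m) w
      inC′ w∈ = let 1≤j , _ , k< = inC w∈ in 1≤j , top w∈ , k<

  saturated-clique : ∀ m → ∃ λ C → IsClique (suc m) C × length C ≡ f (suc m)
  saturated-clique m with LayerInvariant.saturated (invariant m)
  ... | U , U∈ , |U|≡ with ∈⇒at U∈
  ...   | p , p< , refl =
    (suc m , p) ∷ up (suc m , p) ,
    cone-IsClique (invariant m) p< id (proj₂ (Admissible.isClique (admissible-up (invariant m) p))) ,
    trans (cong suc |U|≡) (suc[n∸1]≡n (1≤slow sf m))

mainTheorem7 : (ℓ : ℕ) → 4 ≤ ℓ → (f : ℕ → ℕ) → Slow f →
    (i : ℕ) → 2 ≤ i → Construction.CliqueNumber≡ f ℓ i (f i)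
mainTheorem7 ℓ 4≤ℓ f sf i@(suc m) 2≤i = saturated-clique m , clique-bound i 2≤i
  where open LayeredWheel ℓ 4≤ℓ f sf
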